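{- We have $\mathrm{RS}_0(111,1212)=\mathrm{RS}_1(111,1212)=1$, and for $n\ge 2$, $$\mathrm{RS}_n(111,1212)=\mathrm{RS}_{n-1}(111,1212)+\sum_{k=0}^{n-2}q^k\,\mathrm{RS}_k(111,1212)\,\mathrm{RS}_{n-k-2}(111,1212).$$
   Context: A restricted growth function (RGF) of length $n$ is a sequence $w=w_1\dots w_n$ of positive integers with $w_1=1$ and $w_i\le 1+\max\{w_1,\dots,w_{i-1}\}$ for $i\ge 2$; $R_0$ consists of the empty word and $R_n$ is the set of RGFs of length $n$. The standardization of a word replaces every occurrence of its smallest letter by $1$, of its next smallest letter by $2$, and so on. An RGF $w$ contains an RGF $v$ if some subword (subsequence, not necessarily consecutive) of $w$ standardizes to $v$; otherwise $w$ avoids $v$. $R_n(v_1,v_2)$ is the set of $w\in R_n$ avoiding both $v_1$ and $v_2$. For a word $w$ and position $j$, $\mathrm{rs}(w_j)$ is the number of distinct values $w_i$ with $i>j$ and $w_i<w_j$, $\mathrm{rs}(w)=\sum_j\mathrm{rs}(w_j)$, and $\mathrm{RS}_n(v_1,v_2)=\sum_{w\in R_n(v_1,v_2)}q^{\mathrm{rs}(w)}$. -}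

module Defs where

open import Data.Nat using (ℕ; zero; suc; _+_; _*_; _∸_; _<ᵇ_; _≡ᵇ_)
open import Data.Bool using (Bool; true; false; _∧_; _∨_; not; if_then_else_)
open import Data.List using (List; []; _∷_; map; length; concatMap; upTo)
open import Data.Bool.ListAction using (any)
open import Data.Nat.ListAction using (sum)

-- Words are lists of natural numbers (letters are positive integers).

_==ʷ_ : List ℕ → List ℕ → Bool
[] ==ʷ [] = true
(x ∷ xs) ==ʷ (y ∷ ys) = (x ≡ᵇ y) ∧ (xs ==ʷ ys)
_ ==ʷ _ = false

filterᵇ' : {A : Set} → (A → Bool) → List A → List A
filterᵇ' p [] = []
filterᵇ' p (x ∷ xs) = if p x then x ∷ filterᵇ' p xs else filterᵇ' p xs

elemᵇ : ℕ → List ℕ → Bool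
elemᵇ x = any (λ y → x ≡ᵇ y)

maxL : List ℕ → ℕ
maxL [] = 0
maxL (x ∷ xs) with maxL xs
... | m = if m <ᵇ x then x else m

words : ℕ → ℕ → List (List ℕ)
words zero m = [] ∷ []
words (suc n) m = concatMap (λ w → map (λ a → suc a ∷ w) (upTo m)) (words n m)

-- restricted growth condition: w₁ = 1 and wᵢ ≤ 1 + max{w₁,…,w_{i-1}}
-- (checked left to right, carrying the current maximum; max of empty prefix = 0)
isRGFFrom : ℕ → List ℕ → Bool
isRGFFrom m [] = true
isRGFFrom m (x ∷ xs) =
  ((0 <ᵇ x) ∧ (x <ᵇ suc (suc m))) ∧ isRGFFrom (if m <ᵇ x then x else m) xs

isRGF : List ℕ → Bool
isRGF = isRGFFrom 0

-- R n : the set of RGFs of length n (every RGF of length n has letters ≤ n)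
R : ℕ → List (List ℕ)
R n = filterᵇ' isRGF (words n n)

distinctLess : ℕ → List ℕ → ℕ
distinctLess x l = length (filterᵇ' (λ v → elemᵇ v l) (upTo x))

-- standardization: smallest letter ↦ 1, next smallest ↦ 2, …
std : List ℕ → List ℕ
std w = map (λ x → suc (distinctLess x w)) w

subseqs : List ℕ → List (List ℕ)
subseqs [] = [] ∷ []
subseqs (x ∷ xs) = map (x ∷_) (subseqs xs) Data.List.++ subseqs xs

contains : List ℕ → List ℕ → Bool
contains w v = any (λ s → std s ==ʷ v) (subseqs w)

avoids : List ℕ → List ℕ → Bool
avoids w v = not (contains w v)

p111 p1212 : List ℕ
p111 = 1 ∷ 1 ∷ 1 ∷ []
p1212 = 1 ∷ 2 ∷ 1 ∷ 2 ∷ []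

Rav : ℕ → List (List ℕ)
Rav n = filterᵇ' (λ w → avoids w p111 ∧ avoids w p1212) (R n)

rs : List ℕ → ℕ
rs [] = 0
rs (x ∷ xs) = distinctLess x xs + rs xs

-- Polynomials in q with ℕ coefficients, as coefficient functions.

Poly : Set
Poly = ℕ → ℕ

onePoly : Poly
onePoly zero = 1
onePoly (suc _) = 0

_⊕_ : Poly → Poly → Poly
(f ⊕ g) d = f d + g d

_⊗_ : Poly → Poly → Poly
(f ⊗ g) d = sum (map (λ i → f i * g (d ∸ i)) (upTo (suc d)))

shiftq : ℕ → Poly → Poly
shiftq zero f d = f d
shiftq (suc k) f zero = 0
shiftq (suc k) f (suc d) = shiftq k f d

sumPoly : ℕ → (ℕ → Poly) → Poly
sumPoly zero f = f 0
sumPoly (suc m) f = sumPoly m f ⊕ f (suc m)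

-- RS_n(111,1212) = Σ_{w ∈ R_n(111,1212)} q^{rs(w)}; coefficient of q^d
RS : ℕ → Poly
RS n d = length (filterᵇ' (λ w → rs w ≡ᵇ d) (Rav n))

-- Every w ∈ R_{n+2}(111,1212) starts with 1, and avoiding 111 leaves room for at most one
-- further 1.  If there is none, w = 1(w′+1) with w′ ∈ R_{n+1}(111,1212) and rs w = rs w′.
-- Otherwise w = 1(u+1)1(v+m+1) with u ∈ R_k(111,1212), v ∈ R_{n−k}(111,1212) and m = max u:
-- a letter e ≤ m + 1 after the second 1 already occurs before it, since w is an RGF, and
-- then 111 or 1e1e occurs.  Each of the k letters of u+1 sees exactly one extra smaller
-- value to its right, the second 1, so rs w = k + rs u + rs v.  Conversely both shapes avoid
-- 111 and 1212, and summing q^rs over this bijection gives the recurrence.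
module Submission where

open import Data.Bool using (Bool; true; false; _∧_; _∨_; not; if_then_else_; T)
open import Data.Bool.ListAction using (any)
open import Data.Bool.Properties using (T-∧; ∨-assoc)
open import Data.Empty using (⊥; ⊥-elim)
open import Data.List using (List; []; _∷_; [_]; _++_; map; foldl; applyUpTo; concatMap; length; upTo; reverse; filter; filterᵇ; cartesianProductWith; cartesianProduct)
open import Data.List.Membership.Propositional using (_∈_; _∉_; find)
open import Data.List.Membership.Propositional.Properties using (∈-filter⁺; ∈-filter⁻; ∈-map⁺; ∈-map⁻; ∈-++⁺ˡ; ∈-++⁺ʳ; ∈-++⁻; ∈-upTo⁺; ∈-upTo⁻; ∈-concatMap⁺; ∈-concatMap⁻; ∈-cartesianProduct⁻; ∈-cartesianProductWith⁺; ∈-cartesianProductWith⁻)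
open import Data.List.Membership.Propositional.Properties.WithK using (unique∧set⇒bag)
open import Data.List.Properties using (length-++; length-map; map-injective; map-∘; map-++; ∷-injectiveˡ; ∷-injectiveʳ; ++-assoc; ++-identityʳ; filter-++; upTo-∷ʳ; filter-all; filter-none; filter-reject; reverse-++)
open import Data.List.Relation.Binary.BagAndSetEquality using (∼bag⇒↭)
open import Data.List.Relation.Binary.Disjoint.Propositional using (Disjoint)
open import Data.List.Relation.Binary.Permutation.Propositional using (_↭_)
open import Data.List.Relation.Binary.Permutation.Propositional.Properties using (↭-length; filter-↭)
open import Data.List.Relation.Binary.Pointwise using (≡⇒Pointwise-≡; []; _∷_)
open import Data.List.Relation.Binary.Sublist.Propositional using (_⊆_; _⊈_; []; _∷_; _∷ʳ_; ⊆-refl; ⊆-trans; from∈; to∈)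
import Data.List.Relation.Binary.Sublist.Propositional.Properties as Sublist
open import Data.List.Relation.Unary.All using (All; []; _∷_)
import Data.List.Relation.Unary.All as All
import Data.List.Relation.Unary.All.Properties as All
open import Data.List.Relation.Unary.AllPairs using ([]; _∷_)
open import Data.List.Relation.Unary.Any using (here; there)
import Data.List.Relation.Unary.Any as Any
open import Data.List.Relation.Unary.Any.Properties using (any⁺; any⁻)
open import Data.List.Relation.Unary.Unique.Propositional using (Unique)
import Data.List.Relation.Unary.Unique.Propositional.Properties as Unique
open import Data.Nat using (ℕ; zero; suc; _+_; _*_; _∸_; _⊔_; _<ᵇ_; _≡ᵇ_; _≤_; _<_; _≟_; _≤?_; z≤n; s≤s)
open import Data.Nat.ListAction using (sum)
open import Data.Nat.Properties
open import Algebra.Properties.CommutativeSemigroup +-commutativeSemigroup using (interchange)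
open import Data.Nat.Tactic.RingSolver using (solve-∀)
open import Data.Product using (_×_; _,_; proj₁; proj₂; uncurry; ∃-syntax; ∃₂)
open import Data.Sum using (_⊎_; inj₁; inj₂)
open import Defs
open import Function using (_∘_; id; mk⇔; Equivalence)
open import Relation.Binary.Definitions using (tri<; tri≈; tri>)
open import Relation.Binary.PropositionalEquality hiding ([_])
open import Relation.Nullary using (¬_; ¬?; yes; no)
open import Relation.Nullary.Decidable using (T?)

private variable
  A B C : Set
  a b c k m n x y : ℕ
  xs ys zs s u v w : List ℕ

filterᵇ'≗filterᵇ : (p : A → Bool) → filterᵇ' p ≗ filterᵇ p
filterᵇ'≗filterᵇ p [] = refl
filterᵇ'≗filterᵇ p (x ∷ xs) with p x
... | true = cong (x ∷_) (filterᵇ'≗filterᵇ p xs)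
... | false = filterᵇ'≗filterᵇ p xs

∈-filterᵇ'⁺ : (p : A → Bool) {x : A} {xs : List A} → x ∈ xs → T (p x) → x ∈ filterᵇ' p xs
∈-filterᵇ'⁺ p {xs = xs} x∈xs px = subst (_ ∈_) (sym (filterᵇ'≗filterᵇ p xs)) (∈-filter⁺ (T? ∘ p) x∈xs px)

∈-filterᵇ'⁻ : (p : A → Bool) {x : A} {xs : List A} → x ∈ filterᵇ' p xs → x ∈ xs × T (p x)
∈-filterᵇ'⁻ p {xs = xs} x∈ = ∈-filter⁻ (T? ∘ p) (subst (_ ∈_) (filterᵇ'≗filterᵇ p xs) x∈)

elemᵇ⁺ : x ∈ xs → T (elemᵇ x xs)
elemᵇ⁺ {x} = any⁺ (x ≡ᵇ_) ∘ Any.map (≡⇒≡ᵇ x _)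

elemᵇ⁻ : T (elemᵇ x xs) → x ∈ xs
elemᵇ⁻ {x} {xs} = Any.map (≡ᵇ⇒≡ x _) ∘ any⁻ (x ≡ᵇ_) xs

==ʷ⇒≡ : ∀ xs ys → T (xs ==ʷ ys) → xs ≡ ys
==ʷ⇒≡ [] [] _ = refl
==ʷ⇒≡ (x ∷ xs) (y ∷ ys) eq with Equivalence.to T-∧ eq
... | x≡y , xs≡ys = cong₂ _∷_ (≡ᵇ⇒≡ x y x≡y) (==ʷ⇒≡ xs ys xs≡ys)

==ʷ-refl : ∀ xs → T (xs ==ʷ xs)
==ʷ-refl [] = _
==ʷ-refl (x ∷ xs) = Equivalence.from T-∧ (≡⇒≡ᵇ x x refl , ==ʷ-refl xs)

T-ext : ∀ {b c} → (T b → T c) → (T c → T b) → b ≡ c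
T-ext {true} {true} _ _ = refl
T-ext {true} {false} b⇒c _ = ⊥-elim (b⇒c _)
T-ext {false} {true} _ c⇒b = ⊥-elim (c⇒b _)
T-ext {false} {false} _ _ = refl

T-not⁻ : ∀ {b} → T (not b) → ¬ T b
T-not⁻ {false} _ ()

T-not⁺ : ∀ {b} → ¬ T b → T (not b)
T-not⁺ {true} ¬b = ¬b _
T-not⁺ {false} _ = _

any-++ : (p : A → Bool) (l r : List A) → any p (l ++ r) ≡ any p l ∨ any p r
any-++ p [] r = refl
any-++ p (x ∷ l) r = trans (cong (p x ∨_) (any-++ p l r)) (sym (∨-assoc (p x) _ _))

countBelow : (ℕ → Bool) → ℕ → ℕ
countBelow p x = length (filterᵇ p (upTo x))

distinctLess≡countBelow : ∀ x l → distinctLess x l ≡ countBelow (λ v → elemᵇ v l) x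
distinctLess≡countBelow x l = cong length (filterᵇ'≗filterᵇ (λ v → elemᵇ v l) (upTo x))

countBelow-suc : ∀ p x → countBelow p (suc x) ≡ countBelow p x + (if p x then 1 else 0)
countBelow-suc p x = begin
  length (filterᵇ p (upTo (suc x)))                      ≡⟨ cong (length ∘ filterᵇ p) (sym (upTo-∷ʳ x)) ⟩
  length (filterᵇ p (upTo x ++ [ x ]))                  ≡⟨ cong length (filter-++ (T? ∘ p) (upTo x) [ x ]) ⟩
  length (filterᵇ p (upTo x) ++ filterᵇ p [ x ])        ≡⟨ length-++ (filterᵇ p (upTo x)) ⟩
  countBelow p x + length (filterᵇ p [ x ])             ≡⟨ cong (countBelow p x +_) (last p x) ⟩
  countBelow p x + (if p x then 1 else 0)               ∎
  where
  open ≡-Reasoning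
  last : ∀ p x → length (filterᵇ p [ x ]) ≡ (if p x then 1 else 0)
  last p x with p x
  ... | true = refl
  ... | false = refl

countBelow-+ : ∀ p k x → countBelow p (k + x) ≡ countBelow p k + countBelow (λ v → p (k + v)) x
countBelow-+ p k zero = trans (cong (countBelow p) (+-identityʳ k)) (sym (+-identityʳ _))
countBelow-+ p k (suc x) = begin
  countBelow p (k + suc x)                               ≡⟨ cong (countBelow p) (+-suc k x) ⟩
  countBelow p (suc (k + x))                             ≡⟨ countBelow-suc p (k + x) ⟩
  countBelow p (k + x) + δ                               ≡⟨ cong (_+ δ) (countBelow-+ p k x) ⟩
  countBelow p k + countBelow p′ x + δ                   ≡⟨ +-assoc (countBelow p k) _ δ ⟩
  countBelow p k + (countBelow p′ x + δ)                 ≡⟨ cong (countBelow p k +_) (sym (countBelow-suc p′ x)) ⟩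
  countBelow p k + countBelow p′ (suc x)                 ∎
  where
  open ≡-Reasoning
  p′ = λ v → p (k + v)
  δ = if p (k + x) then 1 else 0

countBelow-mono : ∀ p → x ≤ y → countBelow p x ≤ countBelow p y
countBelow-mono {x} {y} p x≤y = begin
  countBelow p x                                         ≤⟨ m≤m+n _ _ ⟩
  countBelow p x + countBelow (λ v → p (x + v)) (y ∸ x)  ≡⟨ sym (countBelow-+ p x (y ∸ x)) ⟩
  countBelow p (x + (y ∸ x))                             ≡⟨ cong (countBelow p) (m+[n∸m]≡n x≤y) ⟩
  countBelow p y                                         ∎
  where open ≤-Reasoning

countBelow-cong : ∀ {p q} x → (∀ {v} → v < x → p v ≡ q v) → countBelow p x ≡ countBelow q x
countBelow-cong zero _ = refl
countBelow-cong {p} {q} (suc x) p≡q = begin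
  countBelow p (suc x)                    ≡⟨ countBelow-suc p x ⟩
  countBelow p x + (if p x then 1 else 0) ≡⟨ cong₂ (λ n b → n + (if b then 1 else 0)) (countBelow-cong x (p≡q ∘ m<n⇒m<1+n)) (p≡q ≤-refl) ⟩
  countBelow q x + (if q x then 1 else 0) ≡⟨ sym (countBelow-suc q x) ⟩
  countBelow q (suc x)                    ∎
  where open ≡-Reasoning

countBelow≡0 : ∀ p x → (∀ {v} → v < x → ¬ T (p v)) → countBelow p x ≡ 0
countBelow≡0 p x none = cong length (filter-none (T? ∘ p) (All.tabulate (none ∘ ∈-upTo⁻)))

countBelow-suc-≤ : ∀ p → a < x → T (p a) → suc (countBelow p a) ≤ countBelow p x
countBelow-suc-≤ {a} {x} p a<x pa = begin
  suc (countBelow p a)                    ≡⟨ +-comm 1 _ ⟩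
  countBelow p a + 1                      ≡⟨ cong (λ b → countBelow p a + (if b then 1 else 0)) (T⇒≡true pa) ⟨
  countBelow p a + (if p a then 1 else 0) ≡⟨ countBelow-suc p a ⟨
  countBelow p (suc a)                    ≤⟨ countBelow-mono p a<x ⟩
  countBelow p x                          ∎
  where
  open ≤-Reasoning
  T⇒≡true : ∀ {b} → T b → b ≡ true
  T⇒≡true {true} _ = refl

countBelow-∨ : ∀ p q x → (∀ v → ¬ (T (p v) × T (q v))) →
               countBelow (λ v → p v ∨ q v) x ≡ countBelow p x + countBelow q x
countBelow-∨ p q zero _ = refl
countBelow-∨ p q (suc x) exclusive = begin
  countBelow p∨q (suc x)                                 ≡⟨ countBelow-suc p∨q x ⟩
  countBelow p∨q x + ind (p x ∨ q x)                     ≡⟨ cong₂ _+_ (countBelow-∨ p q x exclusive) (ind-∨ (p x) (q x) (exclusive x)) ⟩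
  countBelow p x + countBelow q x + (ind (p x) + ind (q x)) ≡⟨ interchange (countBelow p x) _ _ _ ⟩
  countBelow p x + ind (p x) + (countBelow q x + ind (q x)) ≡⟨ cong₂ _+_ (countBelow-suc p x) (countBelow-suc q x) ⟨
  countBelow p (suc x) + countBelow q (suc x)            ∎
  where
  open ≡-Reasoning
  p∨q = λ v → p v ∨ q v
  ind : Bool → ℕ
  ind b = if b then 1 else 0
  ind-∨ : ∀ b c → ¬ (T b × T c) → ind (b ∨ c) ≡ ind b + ind c
  ind-∨ true true both = ⊥-elim (both _)
  ind-∨ true false _ = refl
  ind-∨ false c _ = refl

distinctLess-cong : ∀ x {l l′} → (∀ {v} → v < x → v ∈ l → v ∈ l′) → (∀ {v} → v < x → v ∈ l′ → v ∈ l) →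
                    distinctLess x l ≡ distinctLess x l′
distinctLess-cong x {l} {l′} l⊆l′ l′⊆l = begin
  distinctLess x l                          ≡⟨ distinctLess≡countBelow x l ⟩
  countBelow (λ v → elemᵇ v l) x            ≡⟨ countBelow-cong x (λ v<x → T-ext (elemᵇ⁺ ∘ l⊆l′ v<x ∘ elemᵇ⁻) (elemᵇ⁺ ∘ l′⊆l v<x ∘ elemᵇ⁻)) ⟩
  countBelow (λ v → elemᵇ v l′) x           ≡⟨ distinctLess≡countBelow x l′ ⟨
  distinctLess x l′                         ∎
  where open ≡-Reasoning

distinctLess≡0⁺ : ∀ x l → All (x ≤_) l → distinctLess x l ≡ 0
distinctLess≡0⁺ x l x≤l = trans (distinctLess≡countBelow x l)
  (countBelow≡0 _ x (λ v<x v∈l → <⇒≱ v<x (All.lookup x≤l (elemᵇ⁻ v∈l))))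

distinctLess≡0⁻ : ∀ x l → distinctLess x l ≡ 0 → All (x ≤_) l
distinctLess≡0⁻ x l dl≡0 = All.tabulate λ v∈l → ≮⇒≥ λ v<x →
  1+n≰n (subst (suc _ ≤_) (trans (sym (distinctLess≡countBelow x l)) dl≡0)
                          (≤-trans (s≤s z≤n) (countBelow-suc-≤ _ v<x (elemᵇ⁺ v∈l))))

2≤distinctLess : ∀ {x} l → a < b → b < x → a ∈ l → b ∈ l → 2 ≤ distinctLess x l
2≤distinctLess {a} {b} {x} l a<b b<x a∈l b∈l = begin
  2                                   ≤⟨ s≤s (s≤s z≤n) ⟩
  suc (suc (countBelow p a))          ≤⟨ s≤s (countBelow-suc-≤ p a<b (elemᵇ⁺ a∈l)) ⟩
  suc (countBelow p b)                ≤⟨ countBelow-suc-≤ p b<x (elemᵇ⁺ b∈l) ⟩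
  countBelow p x                      ≡⟨ distinctLess≡countBelow x l ⟨
  distinctLess x l                    ∎
  where
  open ≤-Reasoning
  p = λ v → elemᵇ v l

distinctLess-++ : ∀ x {l r} → Disjoint l r → distinctLess x (l ++ r) ≡ distinctLess x l + distinctLess x r
distinctLess-++ x {l} {r} l#r = begin
  distinctLess x (l ++ r)                                       ≡⟨ distinctLess≡countBelow x (l ++ r) ⟩
  countBelow (λ v → elemᵇ v (l ++ r)) x                         ≡⟨ countBelow-cong x (λ {v} _ → any-++ (v ≡ᵇ_) l r) ⟩
  countBelow (λ v → elemᵇ v l ∨ elemᵇ v r) x                    ≡⟨ countBelow-∨ (λ v → elemᵇ v l) (λ v → elemᵇ v r) x (λ v (v∈l , v∈r) → l#r (elemᵇ⁻ {v} v∈l , elemᵇ⁻ {v} v∈r)) ⟩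
  countBelow (λ v → elemᵇ v l) x + countBelow (λ v → elemᵇ v r) x ≡⟨ cong₂ _+_ (distinctLess≡countBelow x l) (distinctLess≡countBelow x r) ⟨
  distinctLess x l + distinctLess x r                           ∎
  where open ≡-Reasoning

distinctLess-[_] : ∀ {x} c → c < x → distinctLess x [ c ] ≡ 1
distinctLess-[_] {x} c c<x = begin
  distinctLess x [ c ]                                    ≡⟨ distinctLess≡countBelow x [ c ] ⟩
  countBelow p x                                          ≡⟨ cong (countBelow p) (m+[n∸m]≡n c<x) ⟨
  countBelow p (suc c + (x ∸ suc c))                      ≡⟨ countBelow-+ p (suc c) (x ∸ suc c) ⟩
  countBelow p (suc c) + countBelow (λ v → p (suc c + v)) (x ∸ suc c)
                                                          ≡⟨ cong₂ _+_ (countBelow-suc p c) (countBelow≡0 (λ v → p (suc c + v)) (x ∸ suc c) (λ _ → above ∘ ≡c)) ⟩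
  countBelow p c + (if (c ≡ᵇ c) ∨ false then 1 else 0) + 0 ≡⟨ cong₂ (λ n b → n + (if b ∨ false then 1 else 0) + 0) (countBelow≡0 p c (λ v<c → ≠c v<c ∘ ≡c)) c≡ᵇc ⟩
  1                                                       ∎
  where
  open ≡-Reasoning
  p = λ v → elemᵇ v [ c ]
  ≡c : ∀ {v} → T (p v) → v ≡ c
  ≡c v∈ with elemᵇ⁻ {xs = [ c ]} v∈
  ... | here v≡c = v≡c
  ... | there ()
  ≠c : ∀ {v} → v < c → v ≢ c
  ≠c v<c refl = <-irrefl refl v<c
  above : ∀ {v} → suc c + v ≢ c
  above {v} e = 1+n≰n (subst (suc c ≤_) e (m≤m+n (suc c) v))
  c≡ᵇc : (c ≡ᵇ c) ≡ true
  c≡ᵇc = T-ext _ (λ _ → ≡⇒≡ᵇ c c refl)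

distinctLess-shift : ∀ k x l → distinctLess (k + x) (map (k +_) l) ≡ distinctLess x l
distinctLess-shift k x l = begin
  distinctLess (k + x) (map (k +_) l)               ≡⟨ distinctLess≡countBelow (k + x) (map (k +_) l) ⟩
  countBelow p (k + x)                              ≡⟨ countBelow-+ p k x ⟩
  countBelow p k + countBelow (λ v → p (k + v)) x   ≡⟨ cong₂ _+_ (countBelow≡0 p k below) (countBelow-cong x (λ _ → T-ext unshift shift)) ⟩
  countBelow (λ v → elemᵇ v l) x                    ≡⟨ distinctLess≡countBelow x l ⟨
  distinctLess x l                                  ∎
  where
  open ≡-Reasoning
  p = λ v → elemᵇ v (map (k +_) l)
  below : ∀ {v} → v < k → ¬ T (p v)
  below {v} v<k v∈ with ∈-map⁻ (k +_) (elemᵇ⁻ {v} {map (k +_) l} v∈)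
  ... | y , _ , refl = m+n≮m k y v<k
  unshift : ∀ {v} → T (p (k + v)) → T (elemᵇ v l)
  unshift {v} v∈ with ∈-map⁻ (k +_) (elemᵇ⁻ {k + v} {map (k +_) l} v∈)
  ... | y , y∈l , k+v≡k+y = elemᵇ⁺ (subst (_∈ l) (sym (+-cancelˡ-≡ k v y k+v≡k+y)) y∈l)
  shift : ∀ {v} → T (elemᵇ v l) → T (p (k + v))
  shift {v} v∈ = elemᵇ⁺ (∈-map⁺ (k +_) (elemᵇ⁻ {v} {l} v∈))

-- Standardization and the patterns 111 and 1212

std≡111⁺ : ∀ a → std (a ∷ a ∷ a ∷ []) ≡ p111
std≡111⁺ a rewrite distinctLess≡0⁺ a (a ∷ a ∷ a ∷ []) (≤-refl ∷ ≤-refl ∷ ≤-refl ∷ []) = refl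

std≡1212⁺ : a < b → std (a ∷ b ∷ a ∷ b ∷ []) ≡ p1212
std≡1212⁺ {a} {b} a<b = cong₂ (λ i j → suc i ∷ suc j ∷ suc i ∷ suc j ∷ [])
  (distinctLess≡0⁺ a abab (≤-refl ∷ <⇒≤ a<b ∷ ≤-refl ∷ <⇒≤ a<b ∷ []))
  (trans (distinctLess-cong b [a]∋ (λ _ → abab∋)) (distinctLess-[ a ] a<b))
  where
  abab = a ∷ b ∷ a ∷ b ∷ []
  [a]∋ : ∀ {v} → v < b → v ∈ abab → v ∈ [ a ]
  [a]∋ v<b (here refl) = here refl
  [a]∋ v<b (there (here refl)) = ⊥-elim (<-irrefl refl v<b)
  [a]∋ v<b (there (there (here refl))) = here refl
  [a]∋ v<b (there (there (there (here refl)))) = ⊥-elim (<-irrefl refl v<b)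
  abab∋ : ∀ {v} → v ∈ [ a ] → v ∈ abab
  abab∋ (here refl) = here refl

std≡1⇒minimum : ∀ {u} l → suc (distinctLess u l) ≡ 1 → All (u ≤_) l
std≡1⇒minimum l e = distinctLess≡0⁻ _ l (suc-injective e)

std≡111⁻ : ∀ s → std s ≡ p111 → ∃[ a ] s ≡ a ∷ a ∷ a ∷ []
std≡111⁻ s@(x ∷ y ∷ z ∷ []) eq with ≡⇒Pointwise-≡ eq
... | ex ∷ ey ∷ ez ∷ [] with std≡1⇒minimum s ex | std≡1⇒minimum s ey | std≡1⇒minimum s ez
...   | _ ∷ x≤y ∷ x≤z ∷ [] | y≤x ∷ _ | z≤x ∷ _ = x , cong₂ (λ y z → x ∷ y ∷ z ∷ []) (≤-antisym y≤x x≤y) (≤-antisym z≤x x≤z)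

std≡1212⁻ : ∀ s → std s ≡ p1212 → ∃₂ λ a b → a < b × s ≡ a ∷ b ∷ a ∷ b ∷ []
std≡1212⁻ s@(x ∷ y ∷ z ∷ t ∷ []) eq with ≡⇒Pointwise-≡ eq
... | ex ∷ ey ∷ ez ∷ et ∷ [] with std≡1⇒minimum s ex | std≡1⇒minimum s ez
...   | x≤s@(_ ∷ _ ∷ x≤z ∷ _) | z≤x ∷ _ = x , y , x<y , cong₂ (λ z t → x ∷ y ∷ z ∷ t ∷ []) (≤-antisym z≤x x≤z) (sym y≡t)
  where
  above-x : ∀ u → suc (distinctLess u s) ≡ 2 → x < u
  above-x u e = ≰⇒> λ u≤x → 0≢1+n (trans (sym (distinctLess≡0⁺ u s (All.map (≤-trans u≤x) x≤s))) (suc-injective e))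
  x<y = above-x y ey
  x<t = above-x t et
  not-two : ∀ u → suc (distinctLess u s) ≡ 2 → ¬ (2 ≤ distinctLess u s)
  not-two u e 2≤ = 1+n≰n (subst (2 ≤_) (suc-injective e) 2≤)
  y≡t : y ≡ t
  y≡t with <-cmp y t
  ... | tri< y<t _ _ = ⊥-elim (not-two t et (2≤distinctLess s x<y y<t (here refl) (there (here refl))))
  ... | tri≈ _ y≡t _ = y≡t
  ... | tri> _ _ t<y = ⊥-elim (not-two y ey (2≤distinctLess s x<t t<y (here refl) (there (there (there (here refl))))))

∈-subseqs⁻ : ∀ {s} w → s ∈ subseqs w → s ⊆ w
∈-subseqs⁻ [] (here refl) = []
∈-subseqs⁻ (x ∷ w) s∈ with ∈-++⁻ (map (x ∷_) (subseqs w)) s∈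
... | inj₂ s∈w = x ∷ʳ ∈-subseqs⁻ w s∈w
... | inj₁ s∈x∷w with ∈-map⁻ (x ∷_) s∈x∷w
...   | t , t∈w , refl = refl ∷ ∈-subseqs⁻ w t∈w

∈-subseqs⁺ : s ⊆ w → s ∈ subseqs w
∈-subseqs⁺ [] = here refl
∈-subseqs⁺ (x ∷ʳ s⊆w) = ∈-++⁺ʳ (map (x ∷_) _) (∈-subseqs⁺ s⊆w)
∈-subseqs⁺ (refl ∷ s⊆w) = ∈-++⁺ˡ (∈-map⁺ (_ ∷_) (∈-subseqs⁺ s⊆w))

contains⁺ : ∀ {v} → s ⊆ w → std s ≡ v → T (contains w v)
contains⁺ {s} s⊆w refl = any⁺ _ (Any.map (λ { refl → ==ʷ-refl (std s) }) (∈-subseqs⁺ s⊆w))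

contains⁻ : ∀ {v} → T (contains w v) → ∃[ s ] s ⊆ w × std s ≡ v
contains⁻ {w} {v} c with find (any⁻ _ (subseqs w) c)
... | s , s∈ , std≡v = s , ∈-subseqs⁻ w s∈ , ==ʷ⇒≡ (std s) v std≡v

Avoids111 : List ℕ → Set
Avoids111 w = ∀ a → a ∷ a ∷ a ∷ [] ⊈ w

Avoids1212 : List ℕ → Set
Avoids1212 w = ∀ {a b} → a < b → a ∷ b ∷ a ∷ b ∷ [] ⊈ w

avoids111⁻ : T (avoids w p111) → Avoids111 w
avoids111⁻ av a aaa⊆w = T-not⁻ av (contains⁺ aaa⊆w (std≡111⁺ a))

avoids111⁺ : Avoids111 w → T (avoids w p111)
avoids111⁺ {w} av = T-not⁺ (refute ∘ contains⁻ {w})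
  where
  refute : ∃[ s ] s ⊆ w × std s ≡ p111 → ⊥
  refute (s , s⊆w , std≡) with std≡111⁻ s std≡
  ... | a , refl = av a s⊆w

avoids1212⁻ : T (avoids w p1212) → Avoids1212 w
avoids1212⁻ av a<b abab⊆w = T-not⁻ av (contains⁺ abab⊆w (std≡1212⁺ a<b))

avoids1212⁺ : Avoids1212 w → T (avoids w p1212)
avoids1212⁺ {w} av = T-not⁺ (refute ∘ contains⁻ {w})
  where
  refute : ∃[ s ] s ⊆ w × std s ≡ p1212 → ⊥
  refute (s , s⊆w , std≡) with std≡1212⁻ s std≡
  ... | a , b , a<b , refl = av a<b s⊆w

-- Restricted growth functions

-- RGFFrom m w: w may follow a prefix of an RGF whose largest letter is m (the relational form of isRGFFrom).
data RGFFrom (m : ℕ) : List ℕ → Set where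
  []  : RGFFrom m []
  _∷_ : ∀ {x xs} → 1 ≤ x × x ≤ suc m → RGFFrom (m ⊔ x) xs → RGFFrom m (x ∷ xs)

RGF : List ℕ → Set
RGF = RGFFrom 0

maxFrom : ℕ → List ℕ → ℕ
maxFrom = foldl _⊔_

if<ᵇ≡⊔ : ∀ m x → (if m <ᵇ x then x else m) ≡ m ⊔ x
if<ᵇ≡⊔ m x with m <ᵇ x in m<ᵇx
... | true = sym (m≤n⇒m⊔n≡n (<⇒≤ (<ᵇ⇒< m x (subst T (sym m<ᵇx) _))))
... | false = sym (m≥n⇒m⊔n≡m (≮⇒≥ λ m<x → subst T m<ᵇx (<⇒<ᵇ m<x)))

isRGFFrom⁻ : ∀ m w → T (isRGFFrom m w) → RGFFrom m w
isRGFFrom⁻ m [] _ = []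
isRGFFrom⁻ m (x ∷ w) t with Equivalence.to T-∧ t
... | bounds , rest with Equivalence.to T-∧ bounds
... | 0<x , x<2+m = (<ᵇ⇒< 0 x 0<x , ≤-pred (<ᵇ⇒< x _ x<2+m))
                    ∷ subst (λ k → RGFFrom k w) (if<ᵇ≡⊔ m x) (isRGFFrom⁻ _ w rest)

isRGFFrom⁺ : RGFFrom m w → T (isRGFFrom m w)
isRGFFrom⁺ [] = _
isRGFFrom⁺ {m} {x ∷ w} ((1≤x , x≤1+m) ∷ r) = Equivalence.from T-∧
  ( Equivalence.from T-∧ (<⇒<ᵇ 1≤x , <⇒<ᵇ (s≤s x≤1+m))
  , subst (λ k → T (isRGFFrom k w)) (sym (if<ᵇ≡⊔ m x)) (isRGFFrom⁺ r))

RGFFrom-++⁺ : RGFFrom m xs → RGFFrom (maxFrom m xs) ys → RGFFrom m (xs ++ ys)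
RGFFrom-++⁺ [] r = r
RGFFrom-++⁺ (x-ok ∷ rx) r = x-ok ∷ RGFFrom-++⁺ rx r

RGFFrom-++⁻ : ∀ xs → RGFFrom m (xs ++ ys) → RGFFrom m xs × RGFFrom (maxFrom m xs) ys
RGFFrom-++⁻ [] r = [] , r
RGFFrom-++⁻ (x ∷ xs) (x-ok ∷ r) = let rx , ry = RGFFrom-++⁻ xs r in x-ok ∷ rx , ry

RGFFrom-shift : ∀ k → RGFFrom m w → RGFFrom (k + m) (map (k +_) w)
RGFFrom-shift k [] = []
RGFFrom-shift {m} {x ∷ w} k ((1≤x , x≤1+m) ∷ r) =
  (≤-trans 1≤x (m≤n+m _ k) , subst (k + x ≤_) (+-suc k m) (+-monoʳ-≤ k x≤1+m))
  ∷ subst (λ j → RGFFrom j _) (+-distribˡ-⊔ k m _) (RGFFrom-shift k r)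

RGFFrom-unshift : ∀ k → All (1 ≤_) w → RGFFrom (k + m) (map (k +_) w) → RGFFrom m w
RGFFrom-unshift k [] [] = []
RGFFrom-unshift {x ∷ w} {m} k (1≤x ∷ pos) ((_ , k+x≤) ∷ r) =
  (1≤x , +-cancelˡ-≤ k x (suc m) (subst (k + x ≤_) (sym (+-suc k m)) k+x≤))
  ∷ RGFFrom-unshift k pos (subst (λ j → RGFFrom j _) (sym (+-distribˡ-⊔ k m x)) r)

maxFrom-shift : ∀ k m w → maxFrom (k + m) (map (k +_) w) ≡ k + maxFrom m w
maxFrom-shift k m [] = refl
maxFrom-shift k m (x ∷ w) =
  trans (cong (λ j → maxFrom j (map (k +_) w)) (sym (+-distribˡ-⊔ k m x))) (maxFrom-shift k (m ⊔ x) w)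

RGFFrom⇒positive : RGFFrom m w → All (1 ≤_) w
RGFFrom⇒positive [] = []
RGFFrom⇒positive ((1≤x , _) ∷ r) = 1≤x ∷ RGFFrom⇒positive r

RGFFrom⇒bounded : RGFFrom m w → All (_≤ m + length w) w
RGFFrom⇒bounded [] = []
RGFFrom⇒bounded {m} {x ∷ w} ((_ , x≤1+m) ∷ r) =
  ≤-trans x≤1+m (≤-trans (m≤m+n (suc m) _) 1+m+∣w∣≤)
  ∷ All.map (λ y≤ → ≤-trans y≤ (≤-trans (+-monoˡ-≤ (length w) (⊔-lub (n≤1+n m) x≤1+m)) 1+m+∣w∣≤)) (RGFFrom⇒bounded r)
  where
  1+m+∣w∣≤ : suc m + length w ≤ m + suc (length w)
  1+m+∣w∣≤ = ≤-reflexive (sym (+-suc m (length w)))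

maxFrom-≥ : ∀ m w → m ≤ maxFrom m w
maxFrom-≥ m [] = ≤-refl
maxFrom-≥ m (x ∷ w) = ≤-trans (m≤m⊔n m x) (maxFrom-≥ (m ⊔ x) w)

maxFrom-upper : ∀ m w → All (_≤ maxFrom m w) w
maxFrom-upper m [] = []
maxFrom-upper m (x ∷ w) = ≤-trans (m≤n⊔m m x) (maxFrom-≥ (m ⊔ x) w) ∷ maxFrom-upper (m ⊔ x) w

RGFFrom-surjective : RGFFrom m w → y ≤ maxFrom m w → y ≤ m ⊎ y ∈ w
RGFFrom-surjective [] y≤m = inj₁ y≤m
RGFFrom-surjective {m} {x ∷ w} {y} ((_ , x≤1+m) ∷ r) y≤max with RGFFrom-surjective r y≤max
... | inj₂ y∈w = inj₂ (there y∈w)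
... | inj₁ y≤m⊔x with x ≤? m
...   | yes x≤m = inj₁ (subst (y ≤_) (m≥n⇒m⊔n≡m x≤m) y≤m⊔x)
...   | no x≰m with y ≤? m
...     | yes y≤m = inj₁ y≤m
...     | no y≰m = inj₂ (here (≤-antisym (subst (y ≤_) (m≤n⇒m⊔n≡n (<⇒≤ (≰⇒> x≰m))) y≤m⊔x) (≤-trans x≤1+m (≰⇒> y≰m))))

∈-words⁻ : ∀ n m → w ∈ words n m → length w ≡ n
∈-words⁻ zero m (here refl) = refl
∈-words⁻ (suc n) m w∈ with find (∈-concatMap⁻ (λ v → map (λ a → suc a ∷ v) (upTo m)) {xs = words n m} w∈)
... | v , v∈ , w∈v with ∈-map⁻ (λ a → suc a ∷ v) w∈v
...   | a , _ , refl = cong suc (∈-words⁻ n m v∈)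

∈-words⁺ : ∀ n m → length w ≡ n → All (λ x → 1 ≤ x × x ≤ m) w → w ∈ words n m
∈-words⁺ zero m refl [] = here refl
∈-words⁺ {suc a ∷ w} (suc n) m refl ((_ , 1+a≤m) ∷ letters) =
  ∈-concatMap⁺ (λ v → map (λ a → suc a ∷ v) (upTo m))
    (Any.map (λ { refl → ∈-map⁺ (λ a → suc a ∷ w) (∈-upTo⁺ 1+a≤m) }) (∈-words⁺ n m refl letters))

⊆-++⁻ : ∀ xs → s ⊆ xs ++ ys → ∃₂ λ s₁ s₂ → s ≡ s₁ ++ s₂ × s₁ ⊆ xs × s₂ ⊆ ys
⊆-++⁻ [] p = [] , _ , refl , [] , p
⊆-++⁻ (x ∷ xs) (.x ∷ʳ p) = let s₁ , s₂ , eq , p₁ , p₂ = ⊆-++⁻ xs p in s₁ , s₂ , eq , x ∷ʳ p₁ , p₂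
⊆-++⁻ (x ∷ xs) (refl ∷ p) = let s₁ , s₂ , eq , p₁ , p₂ = ⊆-++⁻ xs p in x ∷ s₁ , s₂ , cong (x ∷_) eq , refl ∷ p₁ , p₂

⊆-init : ∀ xs ys → xs ++ [ x ] ⊆ ys ++ [ y ] → xs ⊆ ys
⊆-init {x} {y} xs ys p = Sublist.reverse⁻ (Sublist.∷⁻ (subst₂ _⊆_ (reverse-++ xs [ x ]) (reverse-++ ys [ y ]) (Sublist.reverse⁺ p)))

⊆-erase : c ∉ w → All (_≢ c) s → s ⊆ c ∷ w ++ [ c ] → s ⊆ w
⊆-erase {c} {w} {s} c∉w s≢c p = subst₂ _⊆_ (filter-all ≢c? s≢c) erased (Sublist.filter⁺ ≢c? ≢c? (λ { refl → λ x → x }) p)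
  where
  ≢c? = λ x → ¬? (x ≟ c)
  erased : filter ≢c? (c ∷ w ++ [ c ]) ≡ w
  erased = begin
    filter ≢c? (c ∷ w ++ [ c ])          ≡⟨ filter-reject ≢c? (λ c≢c → c≢c refl) ⟩
    filter ≢c? (w ++ [ c ])              ≡⟨ filter-++ ≢c? w [ c ] ⟩
    filter ≢c? w ++ filter ≢c? [ c ]     ≡⟨ cong₂ _++_ (filter-all ≢c? (All.tabulate λ x∈w x≡c → c∉w (subst (_∈ w) x≡c x∈w))) (filter-reject ≢c? (λ c≢c → c≢c refl)) ⟩
    w ++ []                              ≡⟨ ++-identityʳ w ⟩
    w                                    ∎
    where open ≡-Reasoning

Avoids111-[_] : ∀ c → Avoids111 [ c ]
Avoids111-[ c ] a (_ ∷ʳ ())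
Avoids111-[ c ] a (_ ∷ ())

Avoids1212-[_] : ∀ c → Avoids1212 [ c ]
Avoids1212-[ c ] _ (_ ∷ʳ ())
Avoids1212-[ c ] _ (_ ∷ ())

-- Every splitting of aaa or abab into two nonempty factors has a letter in common.
Avoids111-++ : Disjoint xs ys → Avoids111 xs → Avoids111 ys → Avoids111 (xs ++ ys)
Avoids111-++ {xs} xs#ys av-xs av-ys a p with ⊆-++⁻ xs p
... | [] , _ , refl , _ , p₂ = av-ys a p₂
... | _ ∷ [] , _ , refl , p₁ , p₂ = xs#ys (to∈ p₁ , to∈ p₂)
... | _ ∷ _ ∷ [] , _ , refl , p₁ , p₂ = xs#ys (to∈ p₁ , to∈ p₂)
... | _ ∷ _ ∷ _ ∷ [] , _ , refl , p₁ , _ = av-xs a p₁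
... | _ ∷ _ ∷ _ ∷ _ ∷ _ , _ , () , _

Avoids1212-++ : Disjoint xs ys → Avoids1212 xs → Avoids1212 ys → Avoids1212 (xs ++ ys)
Avoids1212-++ {xs} xs#ys av-xs av-ys a<b p with ⊆-++⁻ xs p
... | [] , _ , refl , _ , p₂ = av-ys a<b p₂
... | _ ∷ [] , _ , refl , p₁ , p₂ = xs#ys (to∈ p₁ , to∈ (Sublist.∷ˡ⁻ p₂))
... | _ ∷ _ ∷ [] , _ , refl , p₁ , p₂ = xs#ys (to∈ p₁ , to∈ p₂)
... | _ ∷ _ ∷ _ ∷ [] , _ , refl , p₁ , p₂ = xs#ys (to∈ (Sublist.∷ˡ⁻ p₁) , to∈ p₂)
... | _ ∷ _ ∷ _ ∷ _ ∷ [] , _ , refl , p₁ , _ = av-xs a<b p₁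
... | _ ∷ _ ∷ _ ∷ _ ∷ _ ∷ _ , _ , () , _

Avoids111-enclose : c ∉ w → Avoids111 w → Avoids111 (c ∷ w ++ [ c ])
Avoids111-enclose {c} {w} c∉w av a p with a ≟ c
... | yes refl = c∉w (to∈ (⊆-init [ c ] w (Sublist.∷⁻ p)))
... | no a≢c = av a (⊆-erase c∉w (a≢c ∷ a≢c ∷ a≢c ∷ []) p)

Avoids1212-enclose : c ∉ w → Avoids1212 w → Avoids1212 (c ∷ w ++ [ c ])
Avoids1212-enclose {c} {w} c∉w av {a} {b} a<b p with a ≟ c | b ≟ c
... | yes refl | _ = c∉w (to∈ (Sublist.∷ˡ⁻ (⊆-init (b ∷ c ∷ []) w (Sublist.∷⁻ p))))
... | no a≢c | yes refl = c∉w (to∈ (Sublist.∷ˡ⁻ (Sublist.∷ʳ⁻ a≢c (⊆-init (a ∷ c ∷ a ∷ []) (c ∷ w) p))))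
... | no a≢c | no b≢c = av a<b (⊆-erase c∉w (a≢c ∷ b≢c ∷ a≢c ∷ b≢c ∷ []) p)

Avoids : List ℕ → Set
Avoids w = Avoids111 w × Avoids1212 w

Avoids-[_] : ∀ c → Avoids [ c ]
Avoids-[ c ] = Avoids111-[ c ] , Avoids1212-[ c ]

Avoids-++ : Disjoint xs ys → Avoids xs → Avoids ys → Avoids (xs ++ ys)
Avoids-++ xs#ys (av₁ , av₂) (av₁′ , av₂′) = Avoids111-++ xs#ys av₁ av₁′ , Avoids1212-++ xs#ys av₂ av₂′

Avoids-enclose : c ∉ w → Avoids w → Avoids (c ∷ w ++ [ c ])
Avoids-enclose c∉w (av₁ , av₂) = Avoids111-enclose c∉w av₁ , Avoids1212-enclose c∉w av₂

Avoids-⊆ : s ⊆ w → Avoids w → Avoids s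
Avoids-⊆ s⊆w (av₁ , av₂) = (λ a p → av₁ a (⊆-trans p s⊆w)) , (λ a<b p → av₂ a<b (⊆-trans p s⊆w))

Avoids-unshift : ∀ k → Avoids (map (k +_) w) → Avoids w
Avoids-unshift k (av₁ , av₂) = (λ a p → av₁ (k + a) (Sublist.map⁺ (k +_) p))
                             , (λ a<b p → av₂ (+-monoʳ-< k a<b) (Sublist.map⁺ (k +_) p))

map-∸-+ : ∀ k w → map (_∸ k) (map (k +_) w) ≡ w
map-∸-+ k [] = refl
map-∸-+ k (x ∷ w) = cong₂ _∷_ (m+n∸m≡n k x) (map-∸-+ k w)

⊆-unshift : ∀ k → s ⊆ map (k +_) w → map (_∸ k) s ⊆ w
⊆-unshift {w = w} k p = subst (_ ⊆_) (map-∸-+ k w) (Sublist.map⁺ (_∸ k) p)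

Avoids-shift : ∀ k → Avoids w → Avoids (map (k +_) w)
Avoids-shift k (av₁ , av₂) = (λ a p → av₁ (a ∸ k) (⊆-unshift k p)) , shifted
  where
  shifted : Avoids1212 _
  shifted {a} a<b p with ∈-map⁻ (k +_) (to∈ p)
  ... | y , _ , refl = av₂ (∸-monoˡ-< a<b (m≤m+n k y)) (⊆-unshift k p)

-- The two constructions

record Avoiding (n : ℕ) (w : List ℕ) : Set where
  field
    length≡ : length w ≡ n
    rgf     : RGF w
    avoid   : Avoids w

∈-Rav⁻ : ∀ n → w ∈ Rav n → Avoiding n w
∈-Rav⁻ {w} n w∈ with ∈-filterᵇ'⁻ (λ w → avoids w p111 ∧ avoids w p1212) w∈
... | w∈R , av with ∈-filterᵇ'⁻ isRGF w∈R | Equivalence.to T-∧ av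
...   | w∈words , rgf | av111 , av1212 = record
  { length≡ = ∈-words⁻ n n w∈words ; rgf = isRGFFrom⁻ 0 w rgf ; avoid = avoids111⁻ av111 , avoids1212⁻ av1212 }

∈-Rav⁺ : Avoiding n w → w ∈ Rav n
∈-Rav⁺ {n} {w} record { length≡ = refl ; rgf = rgf ; avoid = av111 , av1212 } =
  ∈-filterᵇ'⁺ _ (∈-filterᵇ'⁺ isRGF (∈-words⁺ n n refl letters) (isRGFFrom⁺ rgf))
                (Equivalence.from T-∧ (avoids111⁺ av111 , avoids1212⁺ av1212))
  where
  letters : All (λ x → 1 ≤ x × x ≤ length w) w
  letters = All.zipWith (λ x → x) (RGFFrom⇒positive rgf , RGFFrom⇒bounded rgf)

Rav-positive : ∀ n → w ∈ Rav n → All (1 ≤_) w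
Rav-positive n = RGFFrom⇒positive ∘ Avoiding.rgf ∘ ∈-Rav⁻ n

-- 1(w+1) and 1(u+1)1(v+max u+1): the avoiders with one, respectively two, letters 1.
lift₁ : List ℕ → List ℕ
lift₁ w = 1 ∷ map suc w

offset : List ℕ → ℕ
offset u = suc (maxFrom 0 u)

lift₂ : List ℕ → List ℕ → List ℕ
lift₂ u v = 1 ∷ map suc u ++ 1 ∷ map (offset u +_) v

shift-above : ∀ k → All (1 ≤_) w → All (k <_) (map (k +_) w)
shift-above k pos = All.map⁺ (All.map (m<m+n k) pos)

Disjoint-≤< : All (_≤ m) xs → All (m <_) ys → Disjoint xs ys
Disjoint-≤< xs≤m m<ys (v∈xs , v∈ys) = <⇒≱ (All.lookup m<ys v∈ys) (All.lookup xs≤m v∈xs)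

lift₂-enclosed : ∀ u v → lift₂ u v ≡ (1 ∷ map suc u ++ [ 1 ]) ++ map (offset u +_) v
lift₂-enclosed u v = cong (1 ∷_) (sym (++-assoc (map suc u) [ 1 ] _))

lifted-≤offset : ∀ u → All (_≤ offset u) (1 ∷ map suc u ++ [ 1 ])
lifted-≤offset u = s≤s z≤n ∷ All.++⁺ (All.map⁺ (All.map s≤s (maxFrom-upper 0 u))) (s≤s z≤n ∷ [])

lift₁-avoiding : Avoiding m w → Avoiding (suc m) (lift₁ w)
lift₁-avoiding {w = w} record { length≡ = refl ; rgf = rgf ; avoid = av } = record
  { length≡ = cong suc (length-map suc w)
  ; rgf = (≤-refl , ≤-refl) ∷ RGFFrom-shift 1 rgf
  ; avoid = Avoids-++ (Disjoint-≤< (≤-refl ∷ []) (shift-above 1 (RGFFrom⇒positive rgf))) Avoids-[ 1 ] (Avoids-shift 1 av)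
  }

lift₂-avoiding : k ≤ n → Avoiding k u → Avoiding (n ∸ k) v → Avoiding (suc (suc n)) (lift₂ u v)
lift₂-avoiding {k} {n} {u} {v} k≤n
  record { length≡ = refl ; rgf = rgf-u ; avoid = av-u }
  record { length≡ = ∣v∣≡ ; rgf = rgf-v ; avoid = av-v } = record
  { length≡ = cong suc length≡
  ; rgf = RGFFrom-++⁺ {xs = 1 ∷ map suc u} ((≤-refl , ≤-refl) ∷ RGFFrom-shift 1 rgf-u)
            (subst (λ m → RGFFrom m (1 ∷ V)) (sym (maxFrom-shift 1 0 u))
              ((≤-refl , s≤s z≤n) ∷ subst (λ m → RGFFrom m V) (trans (+-identityʳ o) (cong suc (sym (⊔-identityʳ _)))) (RGFFrom-shift o rgf-v)))
  ; avoid = subst Avoids (sym (lift₂-enclosed u v))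
      (Avoids-++ (Disjoint-≤< (lifted-≤offset u) (shift-above o (RGFFrom⇒positive rgf-v)))
                 (Avoids-enclose (λ 1∈ → <-irrefl refl (All.lookup (shift-above 1 (RGFFrom⇒positive rgf-u)) 1∈)) (Avoids-shift 1 av-u))
                 (Avoids-shift o av-v))
  }
  where
  o = offset u
  V = map (o +_) v
  length≡ : length (map suc u ++ 1 ∷ V) ≡ suc n
  length≡ = begin
    length (map suc u ++ 1 ∷ V)        ≡⟨ length-++ (map suc u) ⟩
    length (map suc u) + suc (length V) ≡⟨ cong₂ (λ i j → i + suc j) (length-map suc u) (trans (length-map (o +_) v) ∣v∣≡) ⟩
    length u + suc (n ∸ length u)       ≡⟨ +-suc (length u) _ ⟩
    suc (length u + (n ∸ length u))     ≡⟨ cong suc (m+[n∸m]≡n k≤n) ⟩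
    suc n                               ∎
    where open ≡-Reasoning

first-occurrence : ∀ c w → All (_≢ c) w ⊎ ∃₂ λ u v → w ≡ u ++ c ∷ v × All (_≢ c) u
first-occurrence c [] = inj₁ []
first-occurrence c (x ∷ w) with x ≟ c
... | yes refl = inj₂ ([] , w , refl , [])
... | no x≢c with first-occurrence c w
...   | inj₁ none = inj₁ (x≢c ∷ none)
...   | inj₂ (u , v , refl , u≢c) = inj₂ (x ∷ u , v , refl , x≢c ∷ u≢c)

unshift : ∀ k w → All (k <_) w → ∃[ w′ ] w ≡ map (k +_) w′ × All (1 ≤_) w′
unshift k [] [] = [] , refl , []
unshift k (x ∷ w) (k<x ∷ k<w) with unshift k w k<w
... | w′ , refl , pos = x ∸ k ∷ w′ , cong (_∷ _) (sym (m+[n∸m]≡n (<⇒≤ k<x))) , m<n⇒0<n∸m k<x ∷ pos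

positive∧≢1⇒>1 : All (1 ≤_) w → All (_≢ 1) w → All (1 <_) w
positive∧≢1⇒>1 pos ≢1 = All.zipWith (λ (1≤x , x≢1) → ≤∧≢⇒< 1≤x (x≢1 ∘ sym)) (pos , ≢1)

suffix-above-offset : ∀ u R → All (1 ≤_) u → RGF (1 ∷ map suc u ++ 1 ∷ R) → Avoids (1 ∷ map suc u ++ 1 ∷ R) →
                      All (offset u <_) R
suffix-above-offset u R pos-u rgf (av111 , av1212) = All.tabulate λ e∈R → ≰⇒> (refute e∈R)
  where
  prefix-rgf : RGF (1 ∷ map suc u)
  prefix-rgf = proj₁ (RGFFrom-++⁻ (1 ∷ map suc u) rgf)
  refute : ∀ {e} → e ∈ R → ¬ e ≤ offset u
  refute {e} e∈R e≤o with RGFFrom-surjective prefix-rgf (subst (e ≤_) (sym (maxFrom-shift 1 0 u)) e≤o)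
  ... | inj₁ e≤0 = <⇒≱ (All.lookup (RGFFrom⇒positive rgf) (there (∈-++⁺ʳ (map suc u) (there e∈R)))) e≤0
  ... | inj₂ (here refl) = av111 1 (refl ∷ Sublist.++⁺ˡ (map suc u) (refl ∷ from∈ e∈R))
  ... | inj₂ (there e∈U) = av1212 (All.lookup (shift-above 1 pos-u) e∈U) (refl ∷ Sublist.++⁺ (from∈ e∈U) (refl ∷ from∈ e∈R))

lift₁-avoiding⁻ : All (1 ≤_) w → Avoiding (suc m) (lift₁ w) → Avoiding m w
lift₁-avoiding⁻ {w} pos record { length≡ = ∣w∣≡ ; rgf = _ ∷ rgf ; avoid = av } = record
  { length≡ = trans (sym (length-map suc w)) (suc-injective ∣w∣≡)
  ; rgf = RGFFrom-unshift 1 pos rgf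
  ; avoid = Avoids-unshift 1 (Avoids-⊆ (1 ∷ʳ ⊆-refl) av) }

lift₂-avoiding⁻ : All (1 ≤_) u → All (1 ≤_) v → Avoiding (suc (suc n)) (lift₂ u v) →
                  length u ≤ n × Avoiding (length u) u × Avoiding (n ∸ length u) v
lift₂-avoiding⁻ {u} {v} {n} pos-u pos-v record { length≡ = ∣w∣≡ ; rgf = _ ∷ rgf ; avoid = av } =
  ∣u∣≤n , avoiding-u , avoiding-v
  where
  ∣u∣ = length u
  o = offset u
  V = map (o +_) v
  ∣u∣+∣v∣≡n : ∣u∣ + length v ≡ n
  ∣u∣+∣v∣≡n = suc-injective (suc-injective (begin
    suc (suc (∣u∣ + length v))                 ≡⟨ cong suc (+-suc ∣u∣ (length v)) ⟨
    suc (∣u∣ + suc (length v))                 ≡⟨ cong₂ (λ i j → suc (i + suc j)) (length-map suc u) (length-map (o +_) v) ⟨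
    suc (length (map suc u) + suc (length V))  ≡⟨ cong suc (length-++ (map suc u)) ⟨
    length (lift₂ u v)                         ≡⟨ ∣w∣≡ ⟩
    suc (suc n)                                ∎))
    where open ≡-Reasoning
  ∣u∣≤n : ∣u∣ ≤ n
  ∣u∣≤n = subst (∣u∣ ≤_) ∣u∣+∣v∣≡n (m≤m+n ∣u∣ (length v))
  rgfs = RGFFrom-++⁻ (map suc u) rgf
  avoiding-u : Avoiding ∣u∣ u
  avoiding-u = record
    { length≡ = refl
    ; rgf = RGFFrom-unshift 1 pos-u (proj₁ rgfs)
    ; avoid = Avoids-unshift 1 (Avoids-⊆ (1 ∷ʳ Sublist.++⁺ʳ (1 ∷ V) ⊆-refl) av) }
  tail-rgf : RGFFrom o (1 ∷ V) → RGFFrom (o + 0) V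
  tail-rgf (_ ∷ r) = subst (λ m → RGFFrom m V) (trans (cong suc (⊔-identityʳ _)) (sym (+-identityʳ o))) r
  avoiding-v : Avoiding (n ∸ ∣u∣) v
  avoiding-v = record
    { length≡ = trans (sym (m+n∸m≡n ∣u∣ (length v))) (cong (_∸ ∣u∣) ∣u∣+∣v∣≡n)
    ; rgf = RGFFrom-unshift o pos-v (tail-rgf (subst (λ m → RGFFrom m (1 ∷ V)) (maxFrom-shift 1 0 u) (proj₂ rgfs)))
    ; avoid = Avoids-unshift o (Avoids-⊆ (1 ∷ʳ Sublist.++⁺ˡ (map suc u) (1 ∷ʳ ⊆-refl)) av) }

lift-shape : Avoiding (suc (suc n)) w →
             (∃[ w′ ] All (1 ≤_) w′ × w ≡ lift₁ w′) ⊎ (∃₂ λ u v → All (1 ≤_) u × All (1 ≤_) v × w ≡ lift₂ u v)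
lift-shape {w = x ∷ rest} record { rgf = (1≤x , x≤1) ∷ rgf ; avoid = av } with ≤-antisym x≤1 1≤x | first-occurrence 1 rest
... | refl | inj₁ rest≢1 with unshift 1 rest (positive∧≢1⇒>1 (RGFFrom⇒positive rgf) rest≢1)
...   | w′ , refl , pos = inj₁ (w′ , pos , refl)
lift-shape {w = x ∷ rest} record { rgf = (1≤x , x≤1) ∷ rgf ; avoid = av } | refl | inj₂ (U , R , refl , U≢1)
  with unshift 1 U (positive∧≢1⇒>1 (All.++⁻ˡ U (RGFFrom⇒positive rgf)) U≢1)
... | u , refl , pos-u with unshift (offset u) R (suffix-above-offset u R pos-u ((≤-refl , ≤-refl) ∷ rgf) av)
...   | v , refl , pos-v = inj₂ (u , v , pos-u , pos-v , refl)

-- The statistic rs on the constructions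

rs-shift : ∀ k w → rs (map (k +_) w) ≡ rs w
rs-shift k [] = refl
rs-shift k (x ∷ w) = cong₂ _+_ (distinctLess-shift k x w) (rs-shift k w)

lifted-positive : ∀ k w → All (1 ≤_) (map (suc k +_) w)
lifted-positive k w = All.map⁺ (All.tabulate λ _ → s≤s z≤n)

rs-lift₁ : ∀ w → rs (lift₁ w) ≡ rs w
rs-lift₁ w = cong₂ _+_ (distinctLess≡0⁺ 1 (map suc w) (lifted-positive 0 w)) (rs-shift 1 w)

+-rearrange : ∀ a l r t → a + 1 + (l + r + t) ≡ suc l + (a + r) + t
+-rearrange = solve-∀

rs-lifted-prefix : ∀ {b V} u → All (1 ≤_) u → All (_≤ b) u → All (suc b <_) V →
                   rs (map suc u ++ 1 ∷ V) ≡ length u + rs u + rs (1 ∷ V)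
rs-lifted-prefix [] _ _ _ = refl
rs-lifted-prefix {b} {V} (x ∷ u) (1≤x ∷ pos) (x≤b ∷ u≤b) b<V = begin
  distinctLess (suc x) (map suc u ++ [ 1 ] ++ V) + rs (map suc u ++ 1 ∷ V)
    ≡⟨ cong₂ _+_ step (rs-lifted-prefix u pos u≤b b<V) ⟩
  distinctLess x u + 1 + (length u + rs u + rs (1 ∷ V))
    ≡⟨ +-rearrange (distinctLess x u) (length u) (rs u) (rs (1 ∷ V)) ⟩
  suc (length u) + (distinctLess x u + rs u) + rs (1 ∷ V) ∎
  where
  open ≡-Reasoning
  u#1V : Disjoint (map suc u) (1 ∷ V)
  u#1V (v∈u , here refl) with ∈-map⁻ suc v∈u
  ... | _ , y∈u , refl = 1+n≰n (All.lookup pos y∈u)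
  u#1V (v∈u , there v∈V) with ∈-map⁻ suc v∈u
  ... | y , y∈u , refl = <⇒≱ (All.lookup b<V v∈V) (s≤s (All.lookup u≤b y∈u))
  step : distinctLess (suc x) (map suc u ++ [ 1 ] ++ V) ≡ distinctLess x u + 1
  step = begin
    distinctLess (suc x) (map suc u ++ [ 1 ] ++ V)                          ≡⟨ distinctLess-++ (suc x) u#1V ⟩
    distinctLess (suc x) (map suc u) + distinctLess (suc x) ([ 1 ] ++ V)    ≡⟨ cong (_ +_) (distinctLess-++ (suc x) (Disjoint-≤< (≤-refl ∷ []) (All.map (≤-<-trans (s≤s z≤n)) b<V))) ⟩
    distinctLess (suc x) (map suc u) + (distinctLess (suc x) [ 1 ] + distinctLess (suc x) V)
      ≡⟨ cong₂ (λ i j → i + (j + distinctLess (suc x) V)) (distinctLess-shift 1 x u) (distinctLess-[ 1 ] (s≤s 1≤x)) ⟩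
    distinctLess x u + (1 + distinctLess (suc x) V)                         ≡⟨ cong (λ i → distinctLess x u + suc i) (distinctLess≡0⁺ (suc x) V (All.map (λ b<v → <⇒≤ (≤-<-trans (s≤s x≤b) b<v)) b<V)) ⟩
    distinctLess x u + 1                                                    ∎

rs-lift₂ : ∀ u v → All (1 ≤_) u → All (1 ≤_) v → rs (lift₂ u v) ≡ length u + rs u + rs v
rs-lift₂ u v pos-u pos-v = begin
  distinctLess 1 (map suc u ++ 1 ∷ V) + rs (map suc u ++ 1 ∷ V)   ≡⟨ cong₂ _+_ (distinctLess≡0⁺ 1 _ (All.++⁺ (lifted-positive 0 u) (≤-refl ∷ lifted-positive _ v)))
                                                                              (rs-lifted-prefix u pos-u (maxFrom-upper 0 u) (shift-above (offset u) pos-v)) ⟩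
  length u + rs u + (distinctLess 1 V + rs V)                       ≡⟨ cong (λ i → length u + rs u + i) (cong₂ _+_ (distinctLess≡0⁺ 1 V (lifted-positive _ v)) (rs-shift (offset u) v)) ⟩
  length u + rs u + rs v                                            ∎
  where
  open ≡-Reasoning
  V = map (offset u +_) v

-- Generating polynomials

0ᴾ : Poly
0ᴾ _ = 0

monomial : ℕ → Poly
monomial r = shiftq r onePoly

monomial-≡ᵇ : ∀ r d → monomial r d ≡ (if r ≡ᵇ d then 1 else 0)
monomial-≡ᵇ zero zero = refl
monomial-≡ᵇ zero (suc d) = refl
monomial-≡ᵇ (suc r) zero = refl
monomial-≡ᵇ (suc r) (suc d) = monomial-≡ᵇ r d

shiftq-cong : ∀ k {F G} → F ≗ G → shiftq k F ≗ shiftq k G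
shiftq-cong zero F≗G d = F≗G d
shiftq-cong (suc k) F≗G zero = refl
shiftq-cong (suc k) F≗G (suc d) = shiftq-cong k F≗G d

shiftq-0ᴾ : ∀ k → shiftq k 0ᴾ ≗ 0ᴾ
shiftq-0ᴾ zero d = refl
shiftq-0ᴾ (suc k) zero = refl
shiftq-0ᴾ (suc k) (suc d) = shiftq-0ᴾ k d

shiftq-⊕ : ∀ k F G → shiftq k (F ⊕ G) ≗ shiftq k F ⊕ shiftq k G
shiftq-⊕ zero F G d = refl
shiftq-⊕ (suc k) F G zero = refl
shiftq-⊕ (suc k) F G (suc d) = shiftq-⊕ k F G d

shiftq-+ : ∀ k r F → shiftq (k + r) F ≗ shiftq k (shiftq r F)
shiftq-+ zero r F d = refl
shiftq-+ (suc k) r F zero = refl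
shiftq-+ (suc k) r F (suc d) = shiftq-+ k r F d

map-applyUpTo : ∀ (h : A → B) f n → map h (applyUpTo f n) ≡ applyUpTo (h ∘ f) n
map-applyUpTo h f zero = refl
map-applyUpTo h f (suc n) = cong (h (f 0) ∷_) (map-applyUpTo h (f ∘ suc) n)

⊗-suc : ∀ F G d → (F ⊗ G) (suc d) ≡ F 0 * G (suc d) + ((F ∘ suc) ⊗ G) d
⊗-suc F G d = cong (F 0 * G (suc d) +_) (cong sum (trans (map-applyUpTo _ suc (suc d)) (sym (map-applyUpTo _ id (suc d)))))

⊗-congˡ : ∀ {F F′} G → F ≗ F′ → F ⊗ G ≗ F′ ⊗ G
⊗-congˡ G F≗F′ zero = cong (λ a → a * G 0 + 0) (F≗F′ 0)
⊗-congˡ {F} {F′} G F≗F′ (suc d) = begin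
  (F ⊗ G) (suc d)                          ≡⟨ ⊗-suc F G d ⟩
  F 0 * G (suc d) + ((F ∘ suc) ⊗ G) d      ≡⟨ cong₂ (λ a b → a * G (suc d) + b) (F≗F′ 0) (⊗-congˡ G (F≗F′ ∘ suc) d) ⟩
  F′ 0 * G (suc d) + ((F′ ∘ suc) ⊗ G) d    ≡⟨ ⊗-suc F′ G d ⟨
  (F′ ⊗ G) (suc d)                         ∎
  where open ≡-Reasoning

0ᴾ-⊗ : ∀ G → 0ᴾ ⊗ G ≗ 0ᴾ
0ᴾ-⊗ G zero = refl
0ᴾ-⊗ G (suc d) = trans (⊗-suc 0ᴾ G d) (0ᴾ-⊗ G d)

monomial-⊗ : ∀ r G → monomial r ⊗ G ≗ shiftq r G
monomial-⊗ zero G zero = trans (+-identityʳ (G 0 + 0)) (+-identityʳ (G 0))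
monomial-⊗ zero G (suc d) = begin
  (onePoly ⊗ G) (suc d)                    ≡⟨ ⊗-suc onePoly G d ⟩
  G (suc d) + 0 + (0ᴾ ⊗ G) d               ≡⟨ cong₂ _+_ (+-identityʳ (G (suc d))) (0ᴾ-⊗ G d) ⟩
  G (suc d) + 0                            ≡⟨ +-identityʳ (G (suc d)) ⟩
  G (suc d)                                ∎
  where open ≡-Reasoning
monomial-⊗ (suc r) G zero = refl
monomial-⊗ (suc r) G (suc d) = trans (⊗-suc (monomial (suc r)) G d) (monomial-⊗ r G d)

⊗-distribʳ-⊕ : ∀ F G H → (F ⊕ G) ⊗ H ≗ (F ⊗ H) ⊕ (G ⊗ H)
⊗-distribʳ-⊕ F G H zero = distrib (F 0) (G 0) (H 0)
  where
  distrib : ∀ a b c → (a + b) * c + 0 ≡ (a * c + 0) + (b * c + 0)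
  distrib = solve-∀
⊗-distribʳ-⊕ F G H (suc d) = begin
  ((F ⊕ G) ⊗ H) (suc d)                                                ≡⟨ ⊗-suc (F ⊕ G) H d ⟩
  (F 0 + G 0) * H (suc d) + (((F ∘ suc) ⊕ (G ∘ suc)) ⊗ H) d            ≡⟨ cong₂ _+_ (*-distribʳ-+ (H (suc d)) (F 0) (G 0)) (⊗-distribʳ-⊕ (F ∘ suc) (G ∘ suc) H d) ⟩
  F 0 * H (suc d) + G 0 * H (suc d) + (((F ∘ suc) ⊗ H) d + ((G ∘ suc) ⊗ H) d) ≡⟨ interchange (F 0 * H (suc d)) _ _ _ ⟩
  (F 0 * H (suc d) + ((F ∘ suc) ⊗ H) d) + (G 0 * H (suc d) + ((G ∘ suc) ⊗ H) d) ≡⟨ cong₂ _+_ (⊗-suc F H d) (⊗-suc G H d) ⟨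
  (F ⊗ H) (suc d) + (G ⊗ H) (suc d)                                    ∎
  where open ≡-Reasoning

-- Σ_{x ∈ X} q^(st x) as a coefficient function; RS n is distribution rs (Rav n) by definition.
distribution : (A → ℕ) → List A → Poly
distribution st X d = length (filterᵇ' (λ x → st x ≡ᵇ d) X)

distribution-∷ : (st : A → ℕ) (x : A) (X : List A) → distribution st (x ∷ X) ≗ monomial (st x) ⊕ distribution st X
distribution-∷ st x X d rewrite monomial-≡ᵇ (st x) d with st x ≡ᵇ d
... | true = refl
... | false = refl

distribution-++ : (st : A → ℕ) (X Y : List A) → distribution st (X ++ Y) ≗ distribution st X ⊕ distribution st Y
distribution-++ st [] Y d = refl
distribution-++ st (x ∷ X) Y d = begin
  distribution st (x ∷ X ++ Y) d                                  ≡⟨ distribution-∷ st x (X ++ Y) d ⟩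
  monomial (st x) d + distribution st (X ++ Y) d                  ≡⟨ cong (monomial (st x) d +_) (distribution-++ st X Y d) ⟩
  monomial (st x) d + (distribution st X d + distribution st Y d) ≡⟨ +-assoc (monomial (st x) d) _ _ ⟨
  monomial (st x) d + distribution st X d + distribution st Y d   ≡⟨ cong (_+ distribution st Y d) (distribution-∷ st x X d) ⟨
  distribution st (x ∷ X) d + distribution st Y d                 ∎
  where open ≡-Reasoning

distribution-map : ∀ (st : A → ℕ) (st′ : B → ℕ) (f : A → B) k X → (∀ {x} → x ∈ X → st′ (f x) ≡ k + st x) →
                   distribution st′ (map f X) ≗ shiftq k (distribution st X)
distribution-map st st′ f k [] _ d = sym (shiftq-0ᴾ k d)
distribution-map st st′ f k (x ∷ X) st-f d = begin
  distribution st′ (f x ∷ map f X) d                                        ≡⟨ distribution-∷ st′ (f x) (map f X) d ⟩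
  monomial (st′ (f x)) d + distribution st′ (map f X) d                     ≡⟨ cong₂ _+_ (cong (λ r → monomial r d) (st-f (here refl)))
                                                                                         (distribution-map st st′ f k X (st-f ∘ there) d) ⟩
  monomial (k + st x) d + shiftq k (distribution st X) d                    ≡⟨ cong (_+ _) (shiftq-+ k (st x) onePoly d) ⟩
  shiftq k (monomial (st x)) d + shiftq k (distribution st X) d             ≡⟨ shiftq-⊕ k (monomial (st x)) (distribution st X) d ⟨
  shiftq k (monomial (st x) ⊕ distribution st X) d                          ≡⟨ shiftq-cong k (λ e → sym (distribution-∷ st x X e)) d ⟩
  shiftq k (distribution st (x ∷ X)) d                                      ∎
  where open ≡-Reasoning

distribution-cartesianProductWith : ∀ (st : A → ℕ) (st′ : B → ℕ) (st″ : C → ℕ) (g : A → B → C) k X Y →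
  (∀ {x y} → x ∈ X → y ∈ Y → st″ (g x y) ≡ k + st x + st′ y) →
  distribution st″ (cartesianProductWith g X Y) ≗ shiftq k (distribution st X ⊗ distribution st′ Y)
distribution-cartesianProductWith st st′ st″ g k [] Y _ d = sym (trans (shiftq-cong k (0ᴾ-⊗ (distribution st′ Y)) d) (shiftq-0ᴾ k d))
distribution-cartesianProductWith st st′ st″ g k (x ∷ X) Y st-g d = begin
  distribution st″ (map (g x) Y ++ cartesianProductWith g X Y) d
    ≡⟨ distribution-++ st″ (map (g x) Y) _ d ⟩
  distribution st″ (map (g x) Y) d + distribution st″ (cartesianProductWith g X Y) d
    ≡⟨ cong₂ _+_ (distribution-map st′ st″ (g x) (k + st x) Y (st-g (here refl)) d)
                 (distribution-cartesianProductWith st st′ st″ g k X Y (st-g ∘ there) d) ⟩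
  shiftq (k + st x) DY d + shiftq k (DX ⊗ DY) d
    ≡⟨ cong (_+ shiftq k (DX ⊗ DY) d) (shiftq-+ k (st x) DY d) ⟩
  shiftq k (shiftq (st x) DY) d + shiftq k (DX ⊗ DY) d
    ≡⟨ shiftq-⊕ k (shiftq (st x) DY) (DX ⊗ DY) d ⟨
  shiftq k (shiftq (st x) DY ⊕ (DX ⊗ DY)) d
    ≡⟨ shiftq-cong k (λ e → cong (_+ (DX ⊗ DY) e) (sym (monomial-⊗ (st x) DY e))) d ⟩
  shiftq k ((monomial (st x) ⊗ DY) ⊕ (DX ⊗ DY)) d
    ≡⟨ shiftq-cong k (λ e → sym (⊗-distribʳ-⊕ (monomial (st x)) DX DY e)) d ⟩
  shiftq k ((monomial (st x) ⊕ DX) ⊗ DY) d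
    ≡⟨ shiftq-cong k (⊗-congˡ DY (λ e → sym (distribution-∷ st x X e))) d ⟩
  shiftq k (distribution st (x ∷ X) ⊗ DY) d
    ∎
  where
  open ≡-Reasoning
  DX = distribution st X
  DY = distribution st′ Y

unionUpTo : ℕ → (ℕ → List A) → List A
unionUpTo zero L = L 0
unionUpTo (suc n) L = unionUpTo n L ++ L (suc n)

distribution-unionUpTo : ∀ (st : A → ℕ) n L (P : ℕ → Poly) → (∀ k → distribution st (L k) ≗ P k) →
                         distribution st (unionUpTo n L) ≗ sumPoly n P
distribution-unionUpTo st zero L P L≗P = L≗P 0
distribution-unionUpTo st (suc n) L P L≗P d =
  trans (distribution-++ st (unionUpTo n L) (L (suc n)) d) (cong₂ _+_ (distribution-unionUpTo st n L P L≗P d) (L≗P (suc n) d))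

distribution-↭ : (st : A → ℕ) {X Y : List A} → X ↭ Y → distribution st X ≗ distribution st Y
distribution-↭ st {X} {Y} X↭Y d = ↭-length (subst₂ _↭_ (sym (filterᵇ'≗filterᵇ p X)) (sym (filterᵇ'≗filterᵇ p Y)) (filter-↭ (T? ∘ p) X↭Y))
  where p = λ x → st x ≡ᵇ d

Unique-filterᵇ' : (p : A → Bool) {X : List A} → Unique X → Unique (filterᵇ' p X)
Unique-filterᵇ' p {X} u = subst Unique (sym (filterᵇ'≗filterᵇ p X)) (Unique.filter⁺ (T? ∘ p) u)

Unique-map⁺-on : ∀ {f : A → B} {X} → (∀ {x y} → x ∈ X → y ∈ X → f x ≡ f y → x ≡ y) → Unique X → Unique (map f X)
Unique-map⁺-on inj [] = []
Unique-map⁺-on inj (x≢X ∷ u) =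
  All.map⁺ (All.tabulate λ y∈X fx≡fy → All.lookup x≢X y∈X (inj (here refl) (there y∈X) fx≡fy))
  ∷ Unique-map⁺-on (λ x∈X y∈X → inj (there x∈X) (there y∈X)) u

cartesianProductWith-defn : ∀ (g : A → B → C) X Y → cartesianProductWith g X Y ≡ map (uncurry g) (cartesianProduct X Y)
cartesianProductWith-defn g [] Y = refl
cartesianProductWith-defn g (x ∷ X) Y =
  trans (cong₂ _++_ (map-∘ Y) (cartesianProductWith-defn g X Y)) (sym (map-++ (uncurry g) (map (x ,_) Y) _))

Unique-cartesianProductWith⁺-on : ∀ (g : A → B → C) {X Y} → Unique X → Unique Y →
  (∀ {x x′ y y′} → x ∈ X → x′ ∈ X → y ∈ Y → y′ ∈ Y → g x y ≡ g x′ y′ → x ≡ x′ × y ≡ y′) →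
  Unique (cartesianProductWith g X Y)
Unique-cartesianProductWith⁺-on g {X} {Y} uX uY inj = subst Unique (sym (cartesianProductWith-defn g X Y))
  (Unique-map⁺-on inj′ (Unique.cartesianProduct⁺ uX uY))
  where
  inj′ : ∀ {p p′} → p ∈ cartesianProduct X Y → p′ ∈ cartesianProduct X Y → uncurry g p ≡ uncurry g p′ → p ≡ p′
  inj′ p∈ p′∈ eq with ∈-cartesianProduct⁻ X Y p∈ | ∈-cartesianProduct⁻ X Y p′∈
  ... | x∈ , y∈ | x′∈ , y′∈ = let x≡x′ , y≡y′ = inj x∈ x′∈ y∈ y′∈ eq in cong₂ _,_ x≡x′ y≡y′

concatMap-map : ∀ (g : A → B → C) X Y → concatMap (λ x → map (g x) Y) X ≡ cartesianProductWith g X Y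
concatMap-map g [] Y = refl
concatMap-map g (x ∷ X) Y = cong (map (g x) Y ++_) (concatMap-map g X Y)

Unique-words : ∀ n m → Unique (words n m)
Unique-words zero m = [] ∷ []
Unique-words (suc n) m = subst Unique (sym (concatMap-map (λ w a → suc a ∷ w) (words n m) (upTo m)))
  (Unique.cartesianProductWith⁺ (λ w a → suc a ∷ w) (λ eq → ∷-injectiveʳ eq , suc-injective (∷-injectiveˡ eq)) (Unique-words n m) (Unique.upTo⁺ m))

Unique-Rav : ∀ n → Unique (Rav n)
Unique-Rav n = Unique-filterᵇ' _ (Unique-filterᵇ' isRGF (Unique-words n n))

++-∷-cancel : c ∉ xs → c ∉ ys → xs ++ c ∷ zs ≡ ys ++ c ∷ w → xs ≡ ys × zs ≡ w
++-∷-cancel {xs = []} {ys = []} _ _ eq = refl , ∷-injectiveʳ eq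
++-∷-cancel {xs = []} {ys = y ∷ ys} _ c∉ys eq = ⊥-elim (c∉ys (here (∷-injectiveˡ eq)))
++-∷-cancel {xs = x ∷ xs} {ys = []} c∉xs _ eq = ⊥-elim (c∉xs (here (sym (∷-injectiveˡ eq))))
++-∷-cancel {xs = x ∷ xs} {ys = y ∷ ys} c∉xs c∉ys eq
  with ∷-injectiveˡ eq | ++-∷-cancel (c∉xs ∘ there) (c∉ys ∘ there) (∷-injectiveʳ eq)
... | refl | refl , zs≡w = refl , zs≡w

1∉lifted : ∀ k → All (1 ≤_) w → 1 ∉ map (suc k +_) w
1∉lifted k pos 1∈ = <⇒≱ (All.lookup (shift-above (suc k) pos) 1∈) (s≤s z≤n)

lift₁-injective : lift₁ w ≡ lift₁ v → w ≡ v
lift₁-injective eq = map-injective suc-injective (∷-injectiveʳ eq)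

lift₂-injective : ∀ {u′ v′} → All (1 ≤_) u → All (1 ≤_) u′ → lift₂ u v ≡ lift₂ u′ v′ → u ≡ u′ × v ≡ v′
lift₂-injective {u} pos pos′ eq with ++-∷-cancel (1∉lifted 0 pos) (1∉lifted 0 pos′) (∷-injectiveʳ eq)
... | U≡U′ , V≡V′ with map-injective suc-injective U≡U′
...   | refl = refl , map-injective (+-cancelˡ-≡ (offset u) _ _) V≡V′

lift₁≢lift₂ : All (1 ≤_) w → lift₁ w ≢ lift₂ u v
lift₁≢lift₂ {w} {u} pos eq = 1∉lifted 0 pos (subst (1 ∈_) (sym (∷-injectiveʳ eq)) (∈-++⁺ʳ (map suc u) (here refl)))

∈-unionUpTo⁻ : ∀ n (L : ℕ → List A) {z} → z ∈ unionUpTo n L → ∃[ k ] k ≤ n × z ∈ L k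
∈-unionUpTo⁻ zero L z∈ = 0 , z≤n , z∈
∈-unionUpTo⁻ (suc n) L z∈ with ∈-++⁻ (unionUpTo n L) z∈
... | inj₁ z∈ᵤ = let k , k≤n , z∈L = ∈-unionUpTo⁻ n L z∈ᵤ in k , m≤n⇒m≤1+n k≤n , z∈L
... | inj₂ z∈L = suc n , ≤-refl , z∈L

∈-unionUpTo⁺ : ∀ n (L : ℕ → List A) {z k} → k ≤ n → z ∈ L k → z ∈ unionUpTo n L
∈-unionUpTo⁺ zero L z≤n z∈ = z∈
∈-unionUpTo⁺ (suc n) L {k = k} k≤1+n z∈ with k ≟ suc n
... | yes refl = ∈-++⁺ʳ (unionUpTo n L) z∈
... | no k≢1+n = ∈-++⁺ˡ (∈-unionUpTo⁺ n L (≤-pred (≤∧≢⇒< k≤1+n k≢1+n)) z∈)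

Unique-unionUpTo : ∀ n (L : ℕ → List A) → (∀ k → Unique (L k)) → (∀ {k k′ z} → z ∈ L k → z ∈ L k′ → k ≡ k′) →
                   Unique (unionUpTo n L)
Unique-unionUpTo zero L unique _ = unique 0
Unique-unionUpTo (suc n) L unique separated = Unique.++⁺ (Unique-unionUpTo n L unique separated) (unique (suc n)) disjoint
  where
  disjoint : Disjoint (unionUpTo n L) (L (suc n))
  disjoint (z∈ᵤ , z∈L) with ∈-unionUpTo⁻ n L z∈ᵤ
  ... | k , k≤n , z∈Lₖ = <⇒≢ (s≤s k≤n) (separated z∈Lₖ z∈L)

lifted₂ : ℕ → ℕ → List (List ℕ)
lifted₂ n k = cartesianProductWith lift₂ (Rav k) (Rav (n ∸ k))

lifted : ℕ → List (List ℕ)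
lifted n = map lift₁ (Rav (suc n)) ++ unionUpTo n (lifted₂ n)

∈-lifted₂⁻ : ∀ n k {z} → z ∈ lifted₂ n k → ∃₂ λ u v → u ∈ Rav k × v ∈ Rav (n ∸ k) × z ≡ lift₂ u v
∈-lifted₂⁻ n k = ∈-cartesianProductWith⁻ lift₂ (Rav k) (Rav (n ∸ k))

lifted₂-separated : ∀ n {k k′ z} → z ∈ lifted₂ n k → z ∈ lifted₂ n k′ → k ≡ k′
lifted₂-separated n {k} {k′} z∈ z∈′ with ∈-lifted₂⁻ n k z∈ | ∈-lifted₂⁻ n k′ z∈′
... | u , v , u∈ , _ , refl | u′ , v′ , u′∈ , _ , eq with lift₂-injective (Rav-positive k u∈) (Rav-positive k′ u′∈) eq
...   | refl , _ = trans (sym (Avoiding.length≡ (∈-Rav⁻ k u∈))) (Avoiding.length≡ (∈-Rav⁻ k′ u′∈))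

Unique-lifted : ∀ n → Unique (lifted n)
Unique-lifted n = Unique.++⁺ (Unique.map⁺ lift₁-injective (Unique-Rav (suc n)))
                            (Unique-unionUpTo n (lifted₂ n) unique-block (lifted₂-separated n)) disjoint
  where
  unique-block : ∀ k → Unique (lifted₂ n k)
  unique-block k = Unique-cartesianProductWith⁺-on lift₂ (Unique-Rav k) (Unique-Rav (n ∸ k))
    (λ u∈ u′∈ _ _ → lift₂-injective (Rav-positive k u∈) (Rav-positive k u′∈))
  disjoint : Disjoint (map lift₁ (Rav (suc n))) (unionUpTo n (lifted₂ n))
  disjoint (z∈₁ , z∈₂) with ∈-map⁻ lift₁ z∈₁ | ∈-unionUpTo⁻ n (lifted₂ n) z∈₂
  ... | w , w∈ , refl | k , _ , z∈ with ∈-lifted₂⁻ n k z∈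
  ...   | u , v , _ , _ , eq = lift₁≢lift₂ (Rav-positive (suc n) w∈) eq

∈-lifted⁺ : w ∈ Rav (suc (suc n)) → w ∈ lifted n
∈-lifted⁺ {n = n} w∈ with ∈-Rav⁻ (suc (suc n)) w∈
... | av with lift-shape av
...   | inj₁ (w′ , pos , refl) = ∈-++⁺ˡ (∈-map⁺ lift₁ (∈-Rav⁺ (lift₁-avoiding⁻ pos av)))
...   | inj₂ (u , v , pos-u , pos-v , refl) with lift₂-avoiding⁻ pos-u pos-v av
...     | ∣u∣≤n , av-u , av-v =
  ∈-++⁺ʳ _ (∈-unionUpTo⁺ n (lifted₂ n) ∣u∣≤n (∈-cartesianProductWith⁺ lift₂ (∈-Rav⁺ av-u) (∈-Rav⁺ av-v)))

∈-lifted⁻ : w ∈ lifted n → w ∈ Rav (suc (suc n))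
∈-lifted⁻ {n = n} w∈ with ∈-++⁻ (map lift₁ (Rav (suc n))) w∈
... | inj₁ w∈₁ with ∈-map⁻ lift₁ w∈₁
...   | w′ , w′∈ , refl = ∈-Rav⁺ (lift₁-avoiding (∈-Rav⁻ (suc n) w′∈))
∈-lifted⁻ {n = n} w∈ | inj₂ w∈₂ with ∈-unionUpTo⁻ n (lifted₂ n) w∈₂
... | k , k≤n , w∈ₖ with ∈-lifted₂⁻ n k w∈ₖ
...   | u , v , u∈ , v∈ , refl = ∈-Rav⁺ (lift₂-avoiding k≤n (∈-Rav⁻ k u∈) (∈-Rav⁻ (n ∸ k) v∈))

Rav↭lifted : ∀ n → Rav (suc (suc n)) ↭ lifted n
Rav↭lifted n = ∼bag⇒↭ (unique∧set⇒bag (Unique-Rav (suc (suc n))) (Unique-lifted n) (mk⇔ (∈-lifted⁺ {n = n}) (∈-lifted⁻ {n = n})))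

RS-recurrence : ∀ n → RS (suc (suc n)) ≗ RS (suc n) ⊕ sumPoly n (λ k → shiftq k (RS k ⊗ RS (n ∸ k)))
RS-recurrence n d = begin
  RS (suc (suc n)) d                                              ≡⟨ distribution-↭ rs (Rav↭lifted n) d ⟩
  distribution rs (lifted n) d                                    ≡⟨ distribution-++ rs (map lift₁ (Rav (suc n))) _ d ⟩
  distribution rs (map lift₁ (Rav (suc n))) d
    + distribution rs (unionUpTo n (lifted₂ n)) d                 ≡⟨ cong₂ _+_
      (distribution-map rs rs lift₁ 0 (Rav (suc n)) (λ {w} _ → rs-lift₁ w) d)
      (distribution-unionUpTo rs n (lifted₂ n) _ (λ k → distribution-cartesianProductWith rs rs rs lift₂ k (Rav k) (Rav (n ∸ k)) (rs-lift₂-block k)) d) ⟩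
  RS (suc n) d + sumPoly n (λ k → shiftq k (RS k ⊗ RS (n ∸ k))) d ∎
  where
  open ≡-Reasoning
  rs-lift₂-block : ∀ k {u v} → u ∈ Rav k → v ∈ Rav (n ∸ k) → rs (lift₂ u v) ≡ k + rs u + rs v
  rs-lift₂-block k {u} {v} u∈ v∈ = trans (rs-lift₂ u v (Rav-positive k u∈) (Rav-positive (n ∸ k) v∈))
                                         (cong (λ l → l + rs u + rs v) (Avoiding.length≡ (∈-Rav⁻ k u∈)))

proposition5p9 : ((d : ℕ) → RS 0 d ≡ onePoly d)
    × ((d : ℕ) → RS 1 d ≡ onePoly d)
    × ((n d : ℕ) → RS (n + 2) d
    ≡ (RS (n + 1) ⊕ sumPoly n (λ k → shiftq k (RS k ⊗ RS (n ∸ k)))) d)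
proposition5p9 = RS₀ , RS₁ , recurrence
  where
  RS₀ : (d : ℕ) → RS 0 d ≡ onePoly d
  RS₀ zero = refl
  RS₀ (suc d) = refl
  RS₁ : (d : ℕ) → RS 1 d ≡ onePoly d
  RS₁ zero = refl
  RS₁ (suc d) = refl
  recurrence : (n d : ℕ) → RS (n + 2) d ≡ (RS (n + 1) ⊕ sumPoly n (λ k → shiftq k (RS k ⊗ RS (n ∸ k)))) d
  recurrence n rewrite +-comm n 2 | +-comm n 1 = RS-recurrence n
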